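{- Let $G$ be a star $5$-critical subcubic multigraph and let $H$ be the multigraph obtained from $G$ by deleting all vertices of degree $1$. Then for any $3_k$-vertex $x$ in $H$ with $k\geq 2$, $|N_H(x)|=3$.
   Context: All multigraphs are finite and loopless; subcubic means every vertex has degree at most $3$. A star $k$-edge-coloring of a multigraph is a proper edge-coloring with colors $\{1,\dots,k\}$ such that no path or cycle of length four (four edges) is bi-colored; $\chi'_s(G)$ is the least such $k$. A multigraph $G$ is star $5$-critical if $\chi'_s(G)>5$ and $\chi'_s(G-v)\leq 5$ for every vertex $v$. Degrees count edges with multiplicity. A $3_k$-vertex in $H$ is a vertex of degree $3$ in $H$ incident (in $H$) to exactly $k$ edges $e$ such that the other end-vertex of $e$ has degree $2$ in $H$. $N_H(x)$ denotes the set of neighbors of $x$ in $H$. -}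

module Defs where

open import Data.Nat using (ℕ; zero; suc; _+_; _≤_)
open import Data.Fin using (Fin; zero; suc; _≟_)
open import Data.Bool using (Bool; true; false; _∧_; _∨_; not; if_then_else_; T)
open import Data.Product using (_×_; _,_; proj₁; proj₂; Σ; ∃)
open import Data.Sum using (_⊎_)
open import Relation.Nullary using (¬_)
open import Relation.Nullary.Decidable using (⌊_⌋)
open import Relation.Binary.PropositionalEquality using (_≡_; _≢_)

countᵇ : ∀ {m} → (Fin m → Bool) → ℕ
countᵇ {zero} p = 0
countᵇ {suc m} p = (if p zero then 1 else 0) + countᵇ (λ i → p (suc i))

anyᵇ : ∀ {m} → (Fin m → Bool) → Bool
anyᵇ {zero} p = false
anyᵇ {suc m} p = p zero ∨ anyᵇ (λ i → p (suc i))

-- A finite loopless multigraph: vertices Fin n, edges Fin m, each edge has two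
-- distinct end-vertices (parallel edges allowed).
record Multigraph : Set where
  field
    n : ℕ
    m : ℕ
    ends : Fin m → Fin n × Fin n
    loopless : ∀ e → proj₁ (ends e) ≢ proj₂ (ends e)

module _ (G : Multigraph) where
  open Multigraph G

  Vertex : Set
  Vertex = Fin n

  Edge : Set
  Edge = Fin m

  VSet : Set
  VSet = Vertex → Bool

  incidentᵇ : Edge → Vertex → Bool
  incidentᵇ e v = ⌊ v ≟ proj₁ (ends e) ⌋ ∨ ⌊ v ≟ proj₂ (ends e) ⌋

  Joins : Edge → Vertex → Vertex → Set
  Joins e u w = ends e ≡ (u , w) ⊎ ends e ≡ (w , u)

  joinsᵇ : Edge → Vertex → Vertex → Bool
  joinsᵇ e u w =
    (⌊ u ≟ proj₁ (ends e) ⌋ ∧ ⌊ w ≟ proj₂ (ends e) ⌋) ∨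
    (⌊ w ≟ proj₁ (ends e) ⌋ ∧ ⌊ u ≟ proj₂ (ends e) ⌋)

  inSᵇ : VSet → Edge → Bool
  inSᵇ S e = S (proj₁ (ends e)) ∧ S (proj₂ (ends e))

  degIn : VSet → Vertex → ℕ
  degIn S v = countᵇ (λ e → inSᵇ S e ∧ incidentᵇ e v)

  allV : VSet
  allV _ = true

  deg : Vertex → ℕ
  deg = degIn allV

  Subcubic : Set
  Subcubic = ∀ v → deg v ≤ 3

  minusV : Vertex → VSet
  minusV v u = not ⌊ u ≟ v ⌋

  ProperIn : ∀ {k} → VSet → (Edge → Fin k) → Set
  ProperIn S c = ∀ e f v → e ≢ f → T (inSᵇ S e) → T (inSᵇ S f) →
    T (incidentᵇ e v) → T (incidentᵇ f v) → c e ≢ c f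

  -- For a proper colouring, being
  -- bi-coloured means c e₁ = c e₃ and c e₂ = c e₄.
  NoBicolored4In : ∀ {k} → VSet → (Edge → Fin k) → Set
  NoBicolored4In S c =
    ∀ (v₀ v₁ v₂ v₃ v₄ : Vertex) (e₁ e₂ e₃ e₄ : Edge) →
    T (inSᵇ S e₁) → T (inSᵇ S e₂) → T (inSᵇ S e₃) → T (inSᵇ S e₄) →
    Joins e₁ v₀ v₁ → Joins e₂ v₁ v₂ → Joins e₃ v₂ v₃ → Joins e₄ v₃ v₄ →
    v₀ ≢ v₁ → v₀ ≢ v₂ → v₀ ≢ v₃ → v₁ ≢ v₂ → v₁ ≢ v₃ → v₂ ≢ v₃ →
    ((v₄ ≢ v₀ × v₄ ≢ v₁ × v₄ ≢ v₂ × v₄ ≢ v₃) ⊎ v₄ ≡ v₀) →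
    ¬ (c e₁ ≡ c e₃ × c e₂ ≡ c e₄)

  StarColoringIn : (k : ℕ) → VSet → (Edge → Fin k) → Set
  StarColoringIn k S c = ProperIn S c × NoBicolored4In S c

  StarColorableIn : ℕ → VSet → Set
  StarColorableIn k S = Σ (Edge → Fin k) (StarColoringIn k S)

  Star5Critical : Set
  Star5Critical = ¬ StarColorableIn 5 allV × (∀ v → StarColorableIn 5 (minusV v))

  Hset : VSet
  Hset v = not ⌊ deg v Data.Nat.≟ 1 ⌋

  degH : Vertex → ℕ
  degH = degIn Hset

  twoNbrEdgesH : Vertex → ℕ
  twoNbrEdgesH x = countᵇ (λ e → inSᵇ Hset e ∧
    ((⌊ x ≟ proj₁ (ends e) ⌋ ∧ ⌊ degH (proj₂ (ends e)) Data.Nat.≟ 2 ⌋) ∨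
     (⌊ x ≟ proj₂ (ends e) ⌋ ∧ ⌊ degH (proj₁ (ends e)) Data.Nat.≟ 2 ⌋)))

  Is3kVertexH : ℕ → Vertex → Set
  Is3kVertexH k x = T (Hset x) × degH x ≡ 3 × twoNbrEdgesH x ≡ k

  nbrCountH : Vertex → ℕ
  nbrCountH x = countᵇ (λ y → anyᵇ (λ e → inSᵇ Hset e ∧ joinsᵇ e x y))

-- Suppose x had two parallel H-edges d₁, d₂ to some y. As degH x = 3 and at least two H-edges at x
-- end at vertices of H-degree 2, y has H-degree 2; so every further edge at y ends in a leaf of G,
-- and G being subcubic there is at most one such pendant edge. Colour G − y by criticality, give
-- d₁ and d₂ two colours missing at the third neighbour z of x, and the pendant edge a colour
-- different from both and from the colour of xz. A bicoloured path of length four through y would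
-- have to continue beyond a leaf or run y–x–z–· with a colour missing at z, so this is a star
-- 5-edge-colouring of G, a contradiction. Hence the three H-edges at x go to distinct vertices.

module Submission where

open import Data.Bool using (Bool; true; false; if_then_else_; T; _∧_; _∨_)
open import Data.Bool.Properties using (T-∨; T-∧)
open import Data.Empty using (⊥; ⊥-elim)
open import Data.Fin using (Fin; zero; suc; _≟_)
open import Data.Fin.Properties using (suc-injective)
open import Data.List using (List; []; _∷_; _++_; length; map)
open import Data.List.Membership.Propositional using (_∈_; _∉_; find)
open import Data.List.Membership.Propositional.Properties using (∈-∃++; ∈-++⁻; ∈-++⁺ˡ; ∈-++⁺ʳ; ∈-map⁺; ∈-map⁻)
import Data.List.Membership.DecPropositional as DecMembership
open import Data.List.Properties using (length-map; length-++-sucʳ; length-tabulate)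
open import Data.List.Relation.Binary.Subset.Propositional using (_⊆_)
open import Data.List.Relation.Unary.All as All using (All; []; _∷_)
import Data.List.Relation.Unary.All.Properties as All
open import Data.List.Relation.Unary.All.Properties using (¬All⇒Any¬)
open import Data.List.Relation.Unary.AllPairs using ([]; _∷_)
open import Data.List.Relation.Unary.Any using (here; there)
open import Data.List.Relation.Unary.Unique.Propositional using (Unique)
import Data.List.Relation.Unary.Unique.Propositional.Properties as Unique
open import Data.Nat using (ℕ; zero; suc; _≤_; _<_; z≤n; s≤s)
import Data.Nat as ℕ
open import Data.Nat.Properties using (≤-trans; ≤-reflexive; <⇒≱; ≤-antisym; 1+n≰n; m≤n⇒m≤1+n)
open import Data.Product using (_×_; _,_; ∃; ∃₂; proj₁; proj₂)
import Data.Product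
open import Data.Sum using (_⊎_; inj₁; inj₂; [_,_])
import Data.Sum
open import Function using (_∘_; id)
open import Function.Bundles using (Equivalence)
open import Relation.Binary.Definitions using (DecidableEquality)
open import Relation.Binary.PropositionalEquality using (_≡_; _≢_; refl; sym; trans; cong; subst; module ≡-Reasoning)
open import Relation.Nullary using (¬_; yes; no)
open import Relation.Nullary.Decidable using (⌊_⌋; T?; toWitness; fromWitness; fromWitnessFalse; decidable-stable)

open import Defs

private
  variable
    A B : Set
    xs ys : List A

unique-⊆⇒length≤ : Unique xs → xs ⊆ ys → length xs ≤ length ys
unique-⊆⇒length≤ [] _ = z≤n
unique-⊆⇒length≤ {xs = x ∷ xs} (x∉xs ∷ xs-unique) x∷xs⊆ys with ∈-∃++ (x∷xs⊆ys (here refl))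
... | ys₁ , ys₂ , refl = ≤-trans (s≤s (unique-⊆⇒length≤ xs-unique xs⊆ys₁ys₂))
                                 (≤-reflexive (sym (length-++-sucʳ ys₁ x ys₂)))
  where
  xs⊆ys₁ys₂ : xs ⊆ ys₁ ++ ys₂
  xs⊆ys₁ys₂ v∈xs with ∈-++⁻ ys₁ (x∷xs⊆ys (there v∈xs))
  ... | inj₁ v∈ys₁ = ∈-++⁺ˡ v∈ys₁
  ... | inj₂ (here refl) = ⊥-elim (All.lookup x∉xs v∈xs refl)
  ... | inj₂ (there v∈ys₂) = ∈-++⁺ʳ ys₁ v∈ys₂

module _ (_≟ᴬ_ : DecidableEquality A) where
  open DecMembership _≟ᴬ_ using (_∈?_)

  length<⇒∃∉ : {xs ys : List A} → Unique xs → length ys < length xs → ∃ λ a → a ∈ xs × a ∉ ys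
  length<⇒∃∉ {xs} {ys} xs-unique ys<xs with All.all? (_∈? ys) xs
  ... | yes xs⊆ys = ⊥-elim (<⇒≱ ys<xs (unique-⊆⇒length≤ xs-unique (All.lookup xs⊆ys)))
  ... | no xs⊈ys = find (¬All⇒Any¬ (_∈? ys) xs xs⊈ys)

  unique-⊆-length≤⇒⊇ : {xs ys : List A} → Unique xs → xs ⊆ ys → length ys ≤ length xs → ys ⊆ xs
  unique-⊆-length≤⇒⊇ {xs} {ys} xs-unique xs⊆ys ys≤xs {a} a∈ys with a ∈? xs
  ... | yes a∈xs = a∈xs
  ... | no a∉xs = ⊥-elim (<⇒≱ (s≤s ys≤xs)
        (unique-⊆⇒length≤ (All.tabulate (λ { b∈xs refl → a∉xs b∈xs }) ∷ xs-unique) a∷xs⊆ys))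
    where
    a∷xs⊆ys : a ∷ xs ⊆ ys
    a∷xs⊆ys (here refl) = a∈ys
    a∷xs⊆ys (there b∈xs) = xs⊆ys b∈xs

unique-map⁺ : ∀ {f : A → B} → (∀ {a b} → a ∈ xs → b ∈ xs → f a ≡ f b → a ≡ b) → Unique xs → Unique (map f xs)
unique-map⁺ f-inj [] = []
unique-map⁺ f-inj (a∉xs ∷ xs-unique) =
  All.map⁺ (All.tabulate (λ b∈xs fa≡fb → All.lookup a∉xs b∈xs (f-inj (here refl) (there b∈xs) fa≡fb))) ∷
  unique-map⁺ (λ a∈ b∈ → f-inj (there a∈) (there b∈)) xs-unique

elements : ∀ {m} → (Fin m → Bool) → List (Fin m)
elements {zero} p = []
elements {suc m} p = if p zero then zero ∷ later else later
  where
  later : List (Fin (suc m))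
  later = map suc (elements (p ∘ suc))

length-elements : ∀ {m} (p : Fin m → Bool) → length (elements p) ≡ countᵇ p
length-elements {zero} p = refl
length-elements {suc m} p with p zero
... | true = cong suc (trans (length-map suc (elements (p ∘ suc))) (length-elements (p ∘ suc)))
... | false = trans (length-map suc (elements (p ∘ suc))) (length-elements (p ∘ suc))

∈-elements⁺ : ∀ {m} (p : Fin m → Bool) {i} → T (p i) → i ∈ elements p
∈-elements⁺ {suc m} p {zero} pi with p zero
... | true = here refl
∈-elements⁺ {suc m} p {suc i} pi with p zero
... | true = there (∈-map⁺ suc (∈-elements⁺ (p ∘ suc) pi))
... | false = ∈-map⁺ suc (∈-elements⁺ (p ∘ suc) pi)

∈-elements⁻ : ∀ {m} (p : Fin m → Bool) {i} → i ∈ elements p → T (p i)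
∈-map-suc-elements⁻ : ∀ {m} (p : Fin (suc m) → Bool) {i} → i ∈ map suc (elements (p ∘ suc)) → T (p i)

∈-elements⁻ {suc m} p i∈ with p zero in p₀
... | true with i∈
...   | here refl rewrite p₀ = _
...   | there i∈later = ∈-map-suc-elements⁻ p i∈later
∈-elements⁻ {suc m} p i∈ | false = ∈-map-suc-elements⁻ p i∈

∈-map-suc-elements⁻ p i∈ with ∈-map⁻ suc i∈
... | j , j∈ , refl = ∈-elements⁻ (p ∘ suc) j∈

elements-unique : ∀ {m} (p : Fin m → Bool) → Unique (elements p)
elements-unique {zero} p = []
elements-unique {suc m} p with p zero
... | true = All.map⁺ (All.universal (λ _ ()) _) ∷ Unique.map⁺ suc-injective (elements-unique (p ∘ suc))
... | false = Unique.map⁺ suc-injective (elements-unique (p ∘ suc))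

countᵇ≤length : ∀ {m} (p : Fin m → Bool) {xs} → (∀ {i} → T (p i) → i ∈ xs) → countᵇ p ≤ length xs
countᵇ≤length p p⊆xs = ≤-trans (≤-reflexive (sym (length-elements p)))
  (unique-⊆⇒length≤ (elements-unique p) (λ i∈ → p⊆xs (∈-elements⁻ p i∈)))

length≤countᵇ : ∀ {m} (p : Fin m → Bool) {xs} → Unique xs → All (T ∘ p) xs → length xs ≤ countᵇ p
length≤countᵇ p xs-unique all-p = ≤-trans (unique-⊆⇒length≤ xs-unique (λ i∈ → ∈-elements⁺ p (All.lookup all-p i∈)))
  (≤-reflexive (length-elements p))

countᵇ≤1⇒≡ : ∀ {m} (p : Fin m → Bool) {i j} → countᵇ p ≤ 1 → T (p i) → T (p j) → i ≡ j
countᵇ≤1⇒≡ p {i} {j} p≤1 pi pj with i ≟ j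
... | yes i≡j = i≡j
... | no i≢j = ⊥-elim (1+n≰n (≤-trans (length≤countᵇ p ((i≢j ∷ []) ∷ [] ∷ []) (pi ∷ pj ∷ [])) p≤1))

length<n⇒∃∉ : ∀ {n} (cs : List (Fin n)) → length cs < n → ∃ (_∉ cs)
length<n⇒∃∉ {n} cs cs<n with length<⇒∃∉ _≟_ (Unique.allFin⁺ n) (subst (length cs <_) (sym (length-tabulate id)) cs<n)
... | α , _ , α∉cs = α , α∉cs

anyᵇ⁺ : ∀ {m} (p : Fin m → Bool) {i} → T (p i) → T (anyᵇ p)
anyᵇ⁺ p {zero} pi = Equivalence.from T-∨ (inj₁ pi)
anyᵇ⁺ p {suc i} pi = Equivalence.from T-∨ (inj₂ (anyᵇ⁺ (p ∘ suc) pi))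

anyᵇ⁻ : ∀ {m} (p : Fin m → Bool) → T (anyᵇ p) → ∃ λ i → T (p i)
anyᵇ⁻ {suc m} p any-p with Equivalence.to T-∨ any-p
... | inj₁ p₀ = zero , p₀
... | inj₂ any-later with anyᵇ⁻ (p ∘ suc) any-later
...   | i , pi = suc i , pi

module _ (G : Multigraph) where
  open Multigraph G using (ends; loopless)

  -- A record rather than T (incidentᵇ G e v), so that e and v can be inferred from the type.
  record Incident (e : Edge G) (v : Vertex G) : Set where
    constructor incident
    field T-incidentᵇ : T (incidentᵇ G e v)
  open Incident public

  private
    variable
      e f : Edge G
      u v w w′ : Vertex G

  T-≟⁻ : ∀ {a b : Vertex G} → T ⌊ a ≟ b ⌋ → a ≡ b
  T-≟⁻ {a} {b} = toWitness {a? = a ≟ b}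

  T-≟⁺ : ∀ {a b : Vertex G} → a ≡ b → T ⌊ a ≟ b ⌋
  T-≟⁺ {a} {b} = fromWitness {a? = a ≟ b}

  pair-≡ : ∀ {p : Vertex G × Vertex G} → u ≡ proj₁ p → w ≡ proj₂ p → p ≡ (u , w)
  pair-≡ refl refl = refl

  joins-sym : Joins G e u w → Joins G e w u
  joins-sym (inj₁ e≡uw) = inj₂ e≡uw
  joins-sym (inj₂ e≡wu) = inj₁ e≡wu

  incident⇒joins : Incident e v → ∃ (Joins G e v)
  incident⇒joins {e} (incident t) with Equivalence.to T-∨ t
  ... | inj₁ v≡₁ = proj₂ (ends e) , inj₁ (pair-≡ (T-≟⁻ v≡₁) refl)
  ... | inj₂ v≡₂ = proj₁ (ends e) , inj₂ (pair-≡ refl (T-≟⁻ v≡₂))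

  joins⇒incidentˡ : Joins G e u w → Incident e u
  joins⇒incidentˡ {e} (inj₁ refl) = incident (Equivalence.from T-∨ (inj₁ (T-≟⁺ {proj₁ (ends e)} refl)))
  joins⇒incidentˡ {e} (inj₂ refl) = incident (Equivalence.from T-∨ (inj₂ (T-≟⁺ {proj₂ (ends e)} refl)))

  joins⇒incidentʳ : Joins G e u w → Incident e w
  joins⇒incidentʳ j = joins⇒incidentˡ (joins-sym j)

  joins⇒≢ : Joins G e u w → u ≢ w
  joins⇒≢ {e} (inj₁ refl) = loopless e
  joins⇒≢ {e} (inj₂ refl) = loopless e ∘ sym

  joins-functional : Joins G e u w → Joins G e u w′ → w ≡ w′
  joins-functional (inj₁ refl) (inj₁ refl) = refl
  joins-functional {e} (inj₁ a) (inj₂ b) = ⊥-elim (loopless e (trans (cong proj₁ a) (sym (cong proj₂ b))))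
  joins-functional {e} (inj₂ a) (inj₁ b) = ⊥-elim (loopless e (trans (cong proj₁ b) (sym (cong proj₂ a))))
  joins-functional (inj₂ refl) (inj₂ refl) = refl

  joins-≢⇒≢ : Joins G e u w → Joins G f u w′ → w ≢ w′ → e ≢ f
  joins-≢⇒≢ euw fuw′ w≢w′ refl = w≢w′ (joins-functional euw fuw′)

  incident-cases : Incident e v → v ≡ proj₁ (ends e) ⊎ v ≡ proj₂ (ends e)
  incident-cases (incident t) with Equivalence.to T-∨ t
  ... | inj₁ v≡₁ = inj₁ (T-≟⁻ v≡₁)
  ... | inj₂ v≡₂ = inj₂ (T-≟⁻ v≡₂)

  joins-incident : Joins G e u w → Incident e v → v ≡ u ⊎ v ≡ w
  joins-incident (inj₁ refl) t = incident-cases t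
  joins-incident (inj₂ refl) t = Data.Sum.swap (incident-cases t)

  ¬incident : Joins G e u w → u ≢ v → w ≢ v → ¬ Incident e v
  ¬incident j u≢v w≢v t with joins-incident j t
  ... | inj₁ v≡u = u≢v (sym v≡u)
  ... | inj₂ v≡w = w≢v (sym v≡w)

  otherEnd : Edge G → Vertex G → Vertex G
  otherEnd e v = if ⌊ v ≟ proj₁ (ends e) ⌋ then proj₂ (ends e) else proj₁ (ends e)

  joins-otherEnd : Incident e v → Joins G e v (otherEnd e v)
  joins-otherEnd {e} {v} t with v ≟ proj₁ (ends e) | incident-cases t
  ... | yes v≡₁ | _ = inj₁ (pair-≡ v≡₁ refl)
  ... | no v≢₁ | inj₁ v≡₁ = ⊥-elim (v≢₁ v≡₁)
  ... | no _ | inj₂ v≡₂ = inj₂ (pair-≡ refl v≡₂)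

  inSᵇ⁻ : (S : VSet G) → Joins G e u w → T (inSᵇ G S e) → T (S u) × T (S w)
  inSᵇ⁻ S (inj₁ refl) t = Equivalence.to T-∧ t
  inSᵇ⁻ S (inj₂ refl) t = Data.Product.swap (Equivalence.to T-∧ t)

  inSᵇ⁺ : (S : VSet G) → Joins G e u w → T (S u) → T (S w) → T (inSᵇ G S e)
  inSᵇ⁺ S (inj₁ refl) Su Sw = Equivalence.from T-∧ (Su , Sw)
  inSᵇ⁺ S (inj₂ refl) Su Sw = Equivalence.from T-∧ (Sw , Su)

  ¬incident⇒inSᵇ-minusV : ¬ Incident e v → T (inSᵇ G (minusV G v) e)
  ¬incident⇒inSᵇ-minusV {e} {v} e∌v = inSᵇ⁺ (minusV G v) (inj₁ refl) (avoids (joins⇒incidentˡ (inj₁ refl)))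
                                                                (avoids (joins⇒incidentʳ (inj₁ refl)))
    where
    avoids : ∀ {u} → Incident e u → T (minusV G v u)
    avoids e∋u = fromWitnessFalse (λ u≡v → e∌v (subst (Incident e) u≡v e∋u))

  deg≡1⇒incident-unique : deg G v ≡ 1 → Incident e v → Incident f v → e ≡ f
  deg≡1⇒incident-unique deg≡1 (incident e∋v) (incident f∋v) = countᵇ≤1⇒≡ _ (≤-reflexive deg≡1) e∋v f∋v

  joinsᵇ⁺ : Joins G e u w → T (joinsᵇ G e u w)
  joinsᵇ⁺ {e} (inj₁ refl) = Equivalence.from T-∨ (inj₁ (Equivalence.from T-∧ (T-≟⁺ {proj₁ (ends e)} refl , T-≟⁺ {proj₂ (ends e)} refl)))
  joinsᵇ⁺ {e} (inj₂ refl) = Equivalence.from T-∨ (inj₂ (Equivalence.from T-∧ (T-≟⁺ {proj₁ (ends e)} refl , T-≟⁺ {proj₂ (ends e)} refl)))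

  joinsᵇ⁻ : T (joinsᵇ G e u w) → Joins G e u w
  joinsᵇ⁻ t with Equivalence.to T-∨ t
  ... | inj₁ uw = let (u≡ , w≡) = Equivalence.to T-∧ uw in inj₁ (pair-≡ (T-≟⁻ u≡) (T-≟⁻ w≡))
  ... | inj₂ wu = let (w≡ , u≡) = Equivalence.to T-∧ wu in inj₂ (pair-≡ (T-≟⁻ w≡) (T-≟⁻ u≡))

  neighbourCount≡degIn : (S : VSet G) (x : Vertex G) →
    (∀ {e f y} → T (inSᵇ G S e) → T (inSᵇ G S f) → Joins G e x y → Joins G f x y → e ≡ f) →
    countᵇ (λ y → anyᵇ (λ e → inSᵇ G S e ∧ joinsᵇ G e x y)) ≡ degIn G S x
  neighbourCount≡degIn S x no-parallel = ≤-antisym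
    (≤-trans (countᵇ≤length isNeighbour neighbours-complete) (≤-reflexive length-neighbours))
    (≤-trans (≤-reflexive (sym length-neighbours))
             (length≤countᵇ isNeighbour neighbours-unique (All.tabulate neighbours-sound)))
    where
    isEdgeAt : Edge G → Bool
    isEdgeAt e = inSᵇ G S e ∧ incidentᵇ G e x
    isNeighbour : Vertex G → Bool
    isNeighbour y = anyᵇ (λ e → inSᵇ G S e ∧ joinsᵇ G e x y)
    neighbours : List (Vertex G)
    neighbours = map (λ e → otherEnd e x) (elements isEdgeAt)

    length-neighbours : length neighbours ≡ degIn G S x
    length-neighbours = trans (length-map _ (elements isEdgeAt)) (length-elements isEdgeAt)

    joins-neighbour : ∀ {e} → T (isEdgeAt e) → Joins G e x (otherEnd e x)
    joins-neighbour t = joins-otherEnd (incident (proj₂ (Equivalence.to T-∧ t)))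

    neighbours-complete : ∀ {y} → T (isNeighbour y) → y ∈ neighbours
    neighbours-complete {y} Ny with anyᵇ⁻ (λ e → inSᵇ G S e ∧ joinsᵇ G e x y) Ny
    ... | e , t = subst (_∈ neighbours) (joins-functional (joins-neighbour e-at-x) xy)
                    (∈-map⁺ (λ e → otherEnd e x) (∈-elements⁺ isEdgeAt e-at-x))
      where
      xy : Joins G e x y
      xy = joinsᵇ⁻ (proj₂ (Equivalence.to T-∧ t))
      e-at-x : T (isEdgeAt e)
      e-at-x = Equivalence.from T-∧ (proj₁ (Equivalence.to T-∧ t) , T-incidentᵇ (joins⇒incidentˡ xy))

    neighbours-sound : ∀ {y} → y ∈ neighbours → T (isNeighbour y)
    neighbours-sound y∈ with ∈-map⁻ (λ e → otherEnd e x) y∈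
    ... | e , e∈ , refl = anyᵇ⁺ _ {e} (Equivalence.from T-∧ (Se , joinsᵇ⁺ (joins-neighbour e-at-x)))
      where
      e-at-x : T (isEdgeAt e)
      e-at-x = ∈-elements⁻ isEdgeAt e∈
      Se : T (inSᵇ G S e)
      Se = proj₁ (Equivalence.to T-∧ e-at-x)

    neighbours-unique : Unique neighbours
    neighbours-unique = unique-map⁺
      (λ e∈ f∈ same-end → no-parallel (inS e∈) (inS f∈) (joins-neighbour (∈-elements⁻ isEdgeAt e∈))
        (subst (Joins G _ x) (sym same-end) (joins-neighbour (∈-elements⁻ isEdgeAt f∈))))
      (elements-unique isEdgeAt)
      where
      inS : ∀ {e} → e ∈ elements isEdgeAt → T (inSᵇ G S e)
      inS e∈ = proj₁ (Equivalence.to T-∧ (∈-elements⁻ isEdgeAt e∈))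

∈-three : ∀ {A : Set} {a b c d : A} → a ∈ b ∷ c ∷ d ∷ [] → a ≡ b ⊎ a ≡ c ⊎ a ≡ d
∈-three (here a≡b) = inj₁ a≡b
∈-three (there (here a≡c)) = inj₂ (inj₁ a≡c)
∈-three (there (there (here a≡d))) = inj₂ (inj₂ a≡d)

closing-distinct : ∀ {A : Set} {v₀ v₁ v₂ v₃ v₄ : A} → v₀ ≢ v₁ → v₀ ≢ v₂ → v₀ ≢ v₃ →
  ((v₄ ≢ v₀ × v₄ ≢ v₁ × v₄ ≢ v₂ × v₄ ≢ v₃) ⊎ v₄ ≡ v₀) → v₄ ≢ v₁ × v₄ ≢ v₂ × v₄ ≢ v₃
closing-distinct _ _ _ (inj₁ (_ , v₄-distinct)) = v₄-distinct
closing-distinct v₀≢v₁ v₀≢v₂ v₀≢v₃ (inj₂ refl) = v₀≢v₁ , v₀≢v₂ , v₀≢v₃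

∉⇒≢ : ∀ {A : Set} {a b : A} {xs} → a ∉ xs → b ∈ xs → a ≢ b
∉⇒≢ a∉xs b∈xs refl = a∉xs b∈xs

module DoubleEdgeExtension
  (G : Multigraph) (subcubic : Subcubic G)
  {x y z : Vertex G} {d₁ d₂ d₃ : Edge G} (d₁≢d₂ : d₁ ≢ d₂)
  (d₁-xy : Joins G d₁ x y) (d₂-xy : Joins G d₂ x y) (d₃-xz : Joins G d₃ x z) (z≢y : z ≢ y)
  (edges-at-x : ∀ {e} → Incident G e x → e ≡ d₁ ⊎ e ≡ d₂ ⊎ e ≡ d₃)
  (pendant-leaf : ∀ {e w} → Joins G e y w → w ≢ x → deg G w ≡ 1)
  (colouring : StarColorableIn G 5 (minusV G y))
  where

  private
    variable
      a b e f : Edge G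
      u₀ u v w w′ : Vertex G

  c : Edge G → Fin 5
  c = proj₁ colouring

  Twin : Edge G → Set
  Twin a = a ≡ d₁ ⊎ a ≡ d₂

  twin-joins : Twin a → Joins G a x y
  twin-joins (inj₁ refl) = d₁-xy
  twin-joins (inj₂ refl) = d₂-xy

  x-edge : Joins G a x u → Twin a × u ≡ y ⊎ a ≡ d₃ × u ≡ z
  x-edge ax with edges-at-x (joins⇒incidentˡ G ax)
  ... | inj₁ refl = inj₁ (inj₁ refl , joins-functional G ax d₁-xy)
  ... | inj₂ (inj₁ refl) = inj₁ (inj₂ refl , joins-functional G ax d₂-xy)
  ... | inj₂ (inj₂ refl) = inj₂ (refl , joins-functional G ax d₃-xz)

  joins-xy⇒twin : Joins G a x y → Twin a
  joins-xy⇒twin axy with x-edge axy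
  ... | inj₁ (twin , _) = twin
  ... | inj₂ (_ , y≡z) = ⊥-elim (z≢y (sym y≡z))

  pendant-not-twin : Joins G a y w → w ≢ x → ¬ Twin a
  pendant-not-twin ayw w≢x twin = w≢x (joins-functional G ayw (joins-sym G (twin-joins twin)))

  pendant-dead-end : Joins G a y w → w ≢ x → Joins G b w u → u ≡ y
  pendant-dead-end {a = a} {w = w} {b = b} ayw w≢x bwu = joins-functional G bwu
    (subst (λ e → Joins G e _ y) a≡b (joins-sym G ayw))
    where
    a≡b : a ≡ b
    a≡b = deg≡1⇒incident-unique G {v = w} (pendant-leaf ayw w≢x) (joins⇒incidentʳ G ayw) (joins⇒incidentˡ G bwu)

  pendant-unique : Joins G a y w → w ≢ x → Joins G b y w′ → w′ ≢ x → a ≡ b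
  pendant-unique {a} {b = b} ayw w≢x byw′ w′≢x with a ≟ b
  ... | yes a≡b = a≡b
  ... | no a≢b = ⊥-elim (1+n≰n (≤-trans (length≤countᵇ _ four-distinct four-at-y) (subcubic y)))
    where
    twins≢pendant : ∀ {e w} → Joins G e y w → w ≢ x → d₁ ≢ e × d₂ ≢ e
    twins≢pendant eyw w≢x = (λ d₁≡e → pendant-not-twin eyw w≢x (inj₁ (sym d₁≡e)))
                   , (λ d₂≡e → pendant-not-twin eyw w≢x (inj₂ (sym d₂≡e)))
    four-distinct : Unique (d₁ ∷ d₂ ∷ a ∷ b ∷ [])
    four-distinct = (d₁≢d₂ ∷ proj₁ (twins≢pendant ayw w≢x) ∷ proj₁ (twins≢pendant byw′ w′≢x) ∷ [])
                  ∷ (proj₂ (twins≢pendant ayw w≢x) ∷ proj₂ (twins≢pendant byw′ w′≢x) ∷ [])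
                  ∷ (a≢b ∷ []) ∷ [] ∷ []
    four-at-y : All (λ e → T (incidentᵇ G e y)) (d₁ ∷ d₂ ∷ a ∷ b ∷ [])
    four-at-y = All.map T-incidentᵇ
      (joins⇒incidentʳ G d₁-xy ∷ joins⇒incidentʳ G d₂-xy ∷ joins⇒incidentˡ G ayw ∷ joins⇒incidentˡ G byw′ ∷ [])

  edges-at-z : List (Edge G)
  edges-at-z = elements (λ e → incidentᵇ G e z)

  Z : List (Fin 5)
  Z = map c edges-at-z

  colour-at-z : Incident G e z → c e ∈ Z
  colour-at-z (incident e∋z) = ∈-map⁺ c (∈-elements⁺ (λ e → incidentᵇ G e z) e∋z)

  |Z|≤3 : length Z ≤ 3
  |Z|≤3 = ≤-trans (≤-reflexive (trans (length-map c edges-at-z) (length-elements (λ e → incidentᵇ G e z)))) (subcubic z)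

  α : Fin 5
  α = proj₁ (length<n⇒∃∉ Z (s≤s (m≤n⇒m≤1+n |Z|≤3)))

  α∉Z : α ∉ Z
  α∉Z = proj₂ (length<n⇒∃∉ Z (s≤s (m≤n⇒m≤1+n |Z|≤3)))

  β : Fin 5
  β = proj₁ (length<n⇒∃∉ (α ∷ Z) (s≤s (s≤s |Z|≤3)))

  β∉α∷Z : β ∉ α ∷ Z
  β∉α∷Z = proj₂ (length<n⇒∃∉ (α ∷ Z) (s≤s (s≤s |Z|≤3)))

  β∉Z : β ∉ Z
  β∉Z = β∉α∷Z ∘ there

  γ : Fin 5
  γ = proj₁ (length<n⇒∃∉ (α ∷ β ∷ c d₃ ∷ []) (s≤s (s≤s (s≤s (s≤s z≤n)))))

  γ∉αβcd₃ : γ ∉ α ∷ β ∷ c d₃ ∷ []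
  γ∉αβcd₃ = proj₂ (length<n⇒∃∉ (α ∷ β ∷ c d₃ ∷ []) (s≤s (s≤s (s≤s (s≤s z≤n)))))

  data Role (e : Edge G) : Set where
    first : e ≡ d₁ → Role e
    second : e ≡ d₂ → Role e
    pendant : Joins G e y w → w ≢ x → Role e
    away : ¬ Incident G e y → Role e

  colour : Role e → Fin 5
  colour (first _) = α
  colour (second _) = β
  colour (pendant _ _) = γ
  colour {e} (away _) = c e

  role : (e : Edge G) → Role e
  role e with e ≟ d₁ | e ≟ d₂ | T? (incidentᵇ G e y)
  ... | yes e≡d₁ | _ | _ = first e≡d₁
  ... | no _ | yes e≡d₂ | _ = second e≡d₂
  ... | no _ | no _ | no e∌y = away (e∌y ∘ T-incidentᵇ)
  ... | no e≢d₁ | no e≢d₂ | yes e∋y with incident⇒joins G (incident e∋y)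
  ...   | w , eyw with w ≟ x
  ...     | no w≢x = pendant eyw w≢x
  ...     | yes refl = ⊥-elim ([ e≢d₁ , e≢d₂ ] (joins-xy⇒twin (joins-sym G eyw)))

  recolour : Edge G → Fin 5
  recolour e = colour (role e)

  colour-irrelevant : (r s : Role e) → colour r ≡ colour s
  colour-irrelevant (first _) (first _) = refl
  colour-irrelevant (first p) (second q) = ⊥-elim (d₁≢d₂ (trans (sym p) q))
  colour-irrelevant (first p) (pendant eyw w≢x) = ⊥-elim (pendant-not-twin eyw w≢x (inj₁ p))
  colour-irrelevant (first p) (away e∌y) = ⊥-elim (e∌y (joins⇒incidentʳ G (twin-joins (inj₁ p))))
  colour-irrelevant (second p) (first q) = ⊥-elim (d₁≢d₂ (trans (sym q) p))
  colour-irrelevant (second _) (second _) = refl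
  colour-irrelevant (second p) (pendant eyw w≢x) = ⊥-elim (pendant-not-twin eyw w≢x (inj₂ p))
  colour-irrelevant (second p) (away e∌y) = ⊥-elim (e∌y (joins⇒incidentʳ G (twin-joins (inj₂ p))))
  colour-irrelevant (pendant eyw w≢x) (first q) = ⊥-elim (pendant-not-twin eyw w≢x (inj₁ q))
  colour-irrelevant (pendant eyw w≢x) (second q) = ⊥-elim (pendant-not-twin eyw w≢x (inj₂ q))
  colour-irrelevant (pendant _ _) (pendant _ _) = refl
  colour-irrelevant (pendant eyw _) (away e∌y) = ⊥-elim (e∌y (joins⇒incidentˡ G eyw))
  colour-irrelevant (away e∌y) (first q) = ⊥-elim (e∌y (joins⇒incidentʳ G (twin-joins (inj₁ q))))
  colour-irrelevant (away e∌y) (second q) = ⊥-elim (e∌y (joins⇒incidentʳ G (twin-joins (inj₂ q))))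
  colour-irrelevant (away e∌y) (pendant eyw _) = ⊥-elim (e∌y (joins⇒incidentˡ G eyw))
  colour-irrelevant (away _) (away _) = refl

  recolour-≡ : (r : Role e) → recolour e ≡ colour r
  recolour-≡ {e} = colour-irrelevant (role e)

  recolour-off-y : Joins G e u w → u ≢ y → w ≢ y → recolour e ≡ c e
  recolour-off-y euw u≢y w≢y = recolour-≡ (away (¬incident G euw u≢y w≢y))

  recolour-twin∉Z : Twin a → recolour a ∉ Z
  recolour-twin∉Z (inj₁ p) = subst (_∉ Z) (sym (recolour-≡ (first p))) α∉Z
  recolour-twin∉Z (inj₂ p) = subst (_∉ Z) (sym (recolour-≡ (second p))) β∉Z

  twin-meets-away-at-x : Twin a → ¬ Incident G b y → Incident G a v → Incident G b v → b ≡ d₃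
  twin-meets-away-at-x {a} {b} {v} twin b∌y a∋v b∋v with joins-incident G {v = v} (twin-joins twin) a∋v
  ... | inj₂ refl = ⊥-elim (b∌y b∋v)
  ... | inj₁ refl with incident⇒joins G {b} {x} b∋v
  ...   | u , bxu with x-edge bxu
  ...     | inj₁ (_ , refl) = ⊥-elim (b∌y (joins⇒incidentʳ G bxu))
  ...     | inj₂ (b≡d₃ , _) = b≡d₃

  away-at-twin-colour∈Z : Twin a → ¬ Incident G b y → Incident G a v → Incident G b v → c b ∈ Z
  away-at-twin-colour∈Z {b = b} twin b∌y a∋v b∋v =
    colour-at-z (subst (λ e → Incident G e z) (sym (twin-meets-away-at-x twin b∌y a∋v b∋v)) (joins⇒incidentʳ G d₃-xz))

  pendant-meets-away : Joins G a y w → w ≢ x → ¬ Incident G b y → Incident G a v → Incident G b v → a ≡ b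
  pendant-meets-away {w = w} {v = v} ayw w≢x b∌y a∋v b∋v with joins-incident G {v = v} ayw a∋v
  ... | inj₁ refl = ⊥-elim (b∌y b∋v)
  ... | inj₂ refl = deg≡1⇒incident-unique G {v = w} (pendant-leaf ayw w≢x) a∋v b∋v

  β≢α : β ≢ α
  β≢α = β∉α∷Z ∘ here

  γ≢α : γ ≢ α
  γ≢α = γ∉αβcd₃ ∘ here

  γ≢β : γ ≢ β
  γ≢β = γ∉αβcd₃ ∘ there ∘ here

  γ≢cd₃ : γ ≢ c d₃
  γ≢cd₃ = γ∉αβcd₃ ∘ there ∘ there ∘ here

  roles-distinct : e ≢ f → Incident G e v → Incident G f v → (r : Role e) (s : Role f) → colour r ≢ colour s
  roles-distinct e≢f _ _ (first p) (first q) _ = e≢f (trans p (sym q))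
  roles-distinct _ _ _ (first _) (second _) = β≢α ∘ sym
  roles-distinct _ _ _ (first _) (pendant _ _) = γ≢α ∘ sym
  roles-distinct _ e∋v f∋v (first p) (away f∌y) = ∉⇒≢ α∉Z (away-at-twin-colour∈Z (inj₁ p) f∌y e∋v f∋v)
  roles-distinct _ _ _ (second _) (first _) = β≢α
  roles-distinct e≢f _ _ (second p) (second q) _ = e≢f (trans p (sym q))
  roles-distinct _ _ _ (second _) (pendant _ _) = γ≢β ∘ sym
  roles-distinct _ e∋v f∋v (second p) (away f∌y) = ∉⇒≢ β∉Z (away-at-twin-colour∈Z (inj₂ p) f∌y e∋v f∋v)
  roles-distinct _ _ _ (pendant _ _) (first _) = γ≢α
  roles-distinct _ _ _ (pendant _ _) (second _) = γ≢β
  roles-distinct e≢f _ _ (pendant eyw w≢x) (pendant fyw′ w′≢x) _ = e≢f (pendant-unique eyw w≢x fyw′ w′≢x)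
  roles-distinct e≢f e∋v f∋v (pendant eyw w≢x) (away f∌y) _ = e≢f (pendant-meets-away eyw w≢x f∌y e∋v f∋v)
  roles-distinct _ e∋v f∋v (away e∌y) (first q) = ∉⇒≢ α∉Z (away-at-twin-colour∈Z (inj₁ q) e∌y f∋v e∋v) ∘ sym
  roles-distinct _ e∋v f∋v (away e∌y) (second q) = ∉⇒≢ β∉Z (away-at-twin-colour∈Z (inj₂ q) e∌y f∋v e∋v) ∘ sym
  roles-distinct e≢f e∋v f∋v (away e∌y) (pendant fyw w≢x) _ = e≢f (sym (pendant-meets-away fyw w≢x e∌y f∋v e∋v))
  roles-distinct {e} {f} {v} e≢f e∋v f∋v (away e∌y) (away f∌y) =
    proj₁ (proj₂ colouring) e f v e≢f (¬incident⇒inSᵇ-minusV G e∌y) (¬incident⇒inSᵇ-minusV G f∌y)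
      (T-incidentᵇ e∋v) (T-incidentᵇ f∋v)

  recolour-proper : ProperIn G (allV G) recolour
  recolour-proper e f v e≢f _ _ e∋v f∋v = roles-distinct {v = v} e≢f (incident e∋v) (incident f∋v) (role e) (role f)

  end-at-y : Joins G a y u → Joins G b u v → Joins G e v w → v ≢ y → w ≢ y → recolour a ≢ recolour e
  end-at-y {u = u} ayu buv evw v≢y w≢y with u ≟ x
  ... | no u≢x = ⊥-elim (v≢y (pendant-dead-end ayu u≢x buv))
  ... | yes refl with x-edge buv
  ...   | inj₁ (_ , v≡y) = ⊥-elim (v≢y v≡y)
  ...   | inj₂ (_ , refl) = ∉⇒≢ (recolour-twin∉Z (joins-xy⇒twin (joins-sym G ayu)))
            (subst (_∈ Z) (sym (recolour-off-y evw z≢y w≢y)) (colour-at-z (joins⇒incidentˡ G evw)))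

  next-to-y : Joins G a u y → Joins G b y v → Joins G e v w → u ≢ v → w ≢ y → recolour a ≢ recolour e
  next-to-y {a = a} {v = v} auy byv evw u≢v w≢y with v ≟ x
  ... | no v≢x = ⊥-elim (w≢y (pendant-dead-end byv v≢x evw))
  ... | yes refl with x-edge evw
  ...   | inj₁ (_ , w≡y) = ⊥-elim (w≢y w≡y)
  ...   | inj₂ (refl , refl) = λ a≡e → γ≢cd₃ (begin
            γ            ≡⟨ recolour-≡ (pendant (joins-sym G auy) u≢v) ⟨
            recolour a   ≡⟨ a≡e ⟩
            recolour d₃  ≡⟨ recolour-off-y d₃-xz (joins⇒≢ G d₁-xy) z≢y ⟩
            c d₃         ∎)
    where open ≡-Reasoning

  through-y : Joins G a u₀ u → Joins G b u y → Joins G e y v → Joins G f v w → u ≢ v → u₀ ≢ y → w ≢ y → ⊥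
  through-y {u = u} au₀u buy eyv fvw u≢v u₀≢y w≢y with u ≟ x
  ... | no u≢x = u₀≢y (pendant-dead-end (joins-sym G buy) u≢x (joins-sym G au₀u))
  ... | yes refl = w≢y (pendant-dead-end eyv (u≢v ∘ sym) fvw)

  recolour-star : NoBicolored4In G (allV G) recolour
  recolour-star v₀ v₁ v₂ v₃ v₄ e₁ e₂ e₃ e₄ _ _ _ _ j₁ j₂ j₃ j₄ v₀≢v₁ v₀≢v₂ v₀≢v₃ v₁≢v₂ v₁≢v₃ v₂≢v₃ closing (b₁ , b₂)
    with closing-distinct v₀≢v₁ v₀≢v₂ v₀≢v₃ closing | v₀ ≟ y | v₁ ≟ y | v₂ ≟ y | v₃ ≟ y | v₄ ≟ y
  ... | _ | yes refl | _ | _ | _ | _ = end-at-y j₁ j₂ j₃ (v₀≢v₂ ∘ sym) (v₀≢v₃ ∘ sym) b₁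
  ... | _ | no _ | yes refl | _ | _ | _ = next-to-y j₁ j₂ j₃ v₀≢v₂ (v₁≢v₃ ∘ sym) b₁
  ... | _ , v₄≢v₂ , _ | no _ | no _ | yes refl | _ | _ = through-y j₁ j₂ j₃ j₄ v₁≢v₃ v₀≢v₂ v₄≢v₂
  -- y at v₃ or v₄: read the path backwards
  ... | _ , v₄≢v₂ , _ | no _ | no _ | no _ | yes refl | _ =
    next-to-y (joins-sym G j₄) (joins-sym G j₃) (joins-sym G j₂) v₄≢v₂ v₁≢v₃ (sym b₂)
  ... | v₄≢v₁ , v₄≢v₂ , _ | no _ | no _ | no _ | no _ | yes refl =
    end-at-y (joins-sym G j₄) (joins-sym G j₃) (joins-sym G j₂) (v₄≢v₂ ∘ sym) (v₄≢v₁ ∘ sym) (sym b₂)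
  ... | _ | no v₀≢y | no v₁≢y | no v₂≢y | no v₃≢y | no v₄≢y =
    proj₂ (proj₂ colouring) v₀ v₁ v₂ v₃ v₄ e₁ e₂ e₃ e₄
      (off-y j₁ v₀≢y v₁≢y) (off-y j₂ v₁≢y v₂≢y) (off-y j₃ v₂≢y v₃≢y) (off-y j₄ v₃≢y v₄≢y)
      j₁ j₂ j₃ j₄ v₀≢v₁ v₀≢v₂ v₀≢v₃ v₁≢v₂ v₁≢v₃ v₂≢v₃ closing
      ( trans (sym (recolour-off-y j₁ v₀≢y v₁≢y)) (trans b₁ (recolour-off-y j₃ v₂≢y v₃≢y))
      , trans (sym (recolour-off-y j₂ v₁≢y v₂≢y)) (trans b₂ (recolour-off-y j₄ v₃≢y v₄≢y)))
    where
    off-y : Joins G e u w → u ≢ y → w ≢ y → T (inSᵇ G (minusV G y) e)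
    off-y euw u≢y w≢y = ¬incident⇒inSᵇ-minusV G (¬incident G euw u≢y w≢y)

  extended : StarColorableIn G 5 (allV G)
  extended = recolour , recolour-proper , recolour-star

module _ (G : Multigraph) where

  HEdge : Edge G → Set
  HEdge e = T (inSᵇ G (Hset G) e)

  isHEdgeAt : Vertex G → Edge G → Bool
  isHEdgeAt v e = inSᵇ G (Hset G) e ∧ incidentᵇ G e v

  isHEdgeAt⁻ : ∀ {v e} → T (isHEdgeAt v e) → HEdge e × Incident G e v
  isHEdgeAt⁻ {e = e} t = Data.Product.map₂ incident (Equivalence.to (T-∧ {inSᵇ G (Hset G) e}) t)

  isHEdgeAt⁺ : ∀ {v e} → HEdge e → Incident G e v → T (isHEdgeAt v e)
  isHEdgeAt⁺ He (incident e∋v) = Equivalence.from T-∧ (He , e∋v)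

  deg≢1⇒∈H : ∀ {v} → deg G v ≢ 1 → T (Hset G v)
  deg≢1⇒∈H {v} = fromWitnessFalse {a? = deg G v ℕ.≟ 1}

  twoNbrEdgesH≤length : ∀ {x xs} → (∀ {e w} → HEdge e → Joins G e x w → degH G w ≡ 2 → e ∈ xs) →
    twoNbrEdgesH G x ≤ length xs
  twoNbrEdgesH≤length {x} {xs} counted⊆xs = countᵇ≤length isCounted counted
    where
    open Multigraph G using (ends)
    isCounted : Edge G → Bool
    isCounted e = inSᵇ G (Hset G) e ∧
      ((⌊ x ≟ proj₁ (ends e) ⌋ ∧ ⌊ degH G (proj₂ (ends e)) ℕ.≟ 2 ⌋) ∨
       (⌊ x ≟ proj₂ (ends e) ⌋ ∧ ⌊ degH G (proj₁ (ends e)) ℕ.≟ 2 ⌋))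
    counted : ∀ {e} → T (isCounted e) → e ∈ xs
    counted {e} t with Equivalence.to T-∧ t
    ... | He , towards with Equivalence.to T-∨ towards
    ...   | inj₁ fwd = let (x≡ , deg≡2) = Equivalence.to T-∧ fwd in
            counted⊆xs He (inj₁ (pair-≡ G (T-≟⁻ G x≡) refl)) (toWitness {a? = degH G (proj₂ (ends e)) ℕ.≟ 2} deg≡2)
    ...   | inj₂ bwd = let (x≡ , deg≡2) = Equivalence.to T-∧ bwd in
            counted⊆xs He (inj₂ (pair-≡ G refl (T-≟⁻ G x≡))) (toWitness {a? = degH G (proj₁ (ends e)) ℕ.≟ 2} deg≡2)

module NoParallelHEdges
  (G : Multigraph) (subcubic : Subcubic G)
  (uncolourable : ¬ StarColorableIn G 5 (allV G)) (critical : ∀ v → StarColorableIn G 5 (minusV G v))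
  {x : Vertex G} (degH-x : degH G x ≡ 3) (2≤twoNbrEdges : 2 ≤ twoNbrEdgesH G x)
  where

  module _ {d₁ d₂ : Edge G} {y : Vertex G} (d₁≢d₂ : d₁ ≢ d₂) (H₁ : HEdge G d₁) (H₂ : HEdge G d₂)
           (d₁-xy : Joins G d₁ x y) (d₂-xy : Joins G d₂ x y) where

    third-HEdge-at-x : ∃₂ λ d₃ z → HEdge G d₃ × Joins G d₃ x z × d₃ ≢ d₁ × d₃ ≢ d₂
    third-HEdge-at-x with length<⇒∃∉ _≟_ {ys = d₁ ∷ d₂ ∷ []} (elements-unique (isHEdgeAt G x))
      (subst (2 <_) (sym (trans (length-elements (isHEdgeAt G x)) degH-x)) (s≤s (s≤s (s≤s z≤n))))
    ... | d₃ , d₃∈ , d₃∉ with isHEdgeAt⁻ G {x} (∈-elements⁻ (isHEdgeAt G x) d₃∈)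
    ...   | H₃ , d₃∋x = d₃ , proj₁ (incident⇒joins G d₃∋x) , H₃ , proj₂ (incident⇒joins G d₃∋x)
                      , d₃∉ ∘ here , d₃∉ ∘ there ∘ here

    module _ {d₃ : Edge G} {z : Vertex G} (H₃ : HEdge G d₃) (d₃-xz : Joins G d₃ x z)
             (d₃≢d₁ : d₃ ≢ d₁) (d₃≢d₂ : d₃ ≢ d₂) where

      edges-at-x : ∀ {e} → Incident G e x → e ≡ d₁ ⊎ e ≡ d₂ ⊎ e ≡ d₃
      edges-at-x (incident e∋x) = ∈-three (unique-⊆-length≤⇒⊇ _≟_ distinct (All.lookup at-x)
        (≤-trans (≤-reflexive (length-elements (λ e → incidentᵇ G e x))) (subcubic x))
        (∈-elements⁺ (λ e → incidentᵇ G e x) e∋x))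
        where
        distinct : Unique (d₁ ∷ d₂ ∷ d₃ ∷ [])
        distinct = (d₁≢d₂ ∷ (d₃≢d₁ ∘ sym) ∷ []) ∷ ((d₃≢d₂ ∘ sym) ∷ []) ∷ [] ∷ []
        at-x : All (_∈ elements (λ e → incidentᵇ G e x)) (d₁ ∷ d₂ ∷ d₃ ∷ [])
        at-x = All.map (∈-elements⁺ (λ e → incidentᵇ G e x) ∘ T-incidentᵇ)
          (joins⇒incidentˡ G d₁-xy ∷ joins⇒incidentˡ G d₂-xy ∷ joins⇒incidentˡ G d₃-xz ∷ [])

      degH-y : degH G y ≡ 2
      degH-y with degH G y ℕ.≟ 2
      ... | yes degH≡2 = degH≡2
      ... | no degH≢2 = ⊥-elim (1+n≰n (≤-trans 2≤twoNbrEdges (twoNbrEdgesH≤length G only-d₃)))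
        where
        only-d₃ : ∀ {e w} → HEdge G e → Joins G e x w → degH G w ≡ 2 → e ∈ d₃ ∷ []
        only-d₃ _ exw degH≡2 with edges-at-x (joins⇒incidentˡ G exw)
        ... | inj₁ refl = ⊥-elim (degH≢2 (subst (λ v → degH G v ≡ 2) (joins-functional G exw d₁-xy) degH≡2))
        ... | inj₂ (inj₁ refl) = ⊥-elim (degH≢2 (subst (λ v → degH G v ≡ 2) (joins-functional G exw d₂-xy) degH≡2))
        ... | inj₂ (inj₂ refl) = here refl

      no-third-HEdge-at-y : ∀ {e} → HEdge G e → Incident G e y → e ≢ d₁ → e ≢ d₂ → ⊥
      no-third-HEdge-at-y {e} He e∋y e≢d₁ e≢d₂ =
        1+n≰n (≤-trans (length≤countᵇ (isHEdgeAt G y) distinct at-y) (≤-reflexive degH-y))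
        where
        distinct : Unique (d₁ ∷ d₂ ∷ e ∷ [])
        distinct = (d₁≢d₂ ∷ (e≢d₁ ∘ sym) ∷ []) ∷ ((e≢d₂ ∘ sym) ∷ []) ∷ [] ∷ []
        at-y : All (T ∘ isHEdgeAt G y) (d₁ ∷ d₂ ∷ e ∷ [])
        at-y = isHEdgeAt⁺ G H₁ (joins⇒incidentʳ G d₁-xy) ∷ isHEdgeAt⁺ G H₂ (joins⇒incidentʳ G d₂-xy)
             ∷ isHEdgeAt⁺ G He e∋y ∷ []

      z≢y : z ≢ y
      z≢y refl = no-third-HEdge-at-y H₃ (joins⇒incidentʳ G d₃-xz) d₃≢d₁ d₃≢d₂

      pendant-leaf : ∀ {e w} → Joins G e y w → w ≢ x → deg G w ≡ 1
      pendant-leaf {w = w} eyw w≢x = decidable-stable (deg G w ℕ.≟ 1) λ deg≢1 →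
        no-third-HEdge-at-y (inSᵇ⁺ G (Hset G) eyw y∈H (deg≢1⇒∈H G {w} deg≢1)) (joins⇒incidentˡ G eyw)
          (joins-≢⇒≢ G eyw (joins-sym G d₁-xy) w≢x) (joins-≢⇒≢ G eyw (joins-sym G d₂-xy) w≢x)
        where
        y∈H : T (Hset G y)
        y∈H = proj₂ (inSᵇ⁻ G (Hset G) d₁-xy H₁)

      third-edge⇒colourable : StarColorableIn G 5 (allV G)
      third-edge⇒colourable = DoubleEdgeExtension.extended G subcubic d₁≢d₂ d₁-xy d₂-xy d₃-xz z≢y
        edges-at-x pendant-leaf (critical y)

    parallel⇒colourable : StarColorableIn G 5 (allV G)
    parallel⇒colourable =
      let (_ , _ , H₃ , d₃-xz , d₃≢d₁ , d₃≢d₂) = third-HEdge-at-x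
      in third-edge⇒colourable H₃ d₃-xz d₃≢d₁ d₃≢d₂

  no-parallel : ∀ {e f y} → HEdge G e → HEdge G f → Joins G e x y → Joins G f x y → e ≡ f
  no-parallel {e} {f} He Hf exy fxy with e ≟ f
  ... | yes e≡f = e≡f
  ... | no e≢f = ⊥-elim (uncolourable (parallel⇒colourable e≢f He Hf exy fxy))

lemma2p4 : (G : Multigraph) → Subcubic G → Star5Critical G →
    ∀ (k : ℕ) (x : Vertex G) → Is3kVertexH G k x → 2 ≤ k → nbrCountH G x ≡ 3
lemma2p4 G subcubic (uncolourable , critical) _ x (_ , degH-x , twoNbrEdges≡k) 2≤k =
  trans (neighbourCount≡degIn G (Hset G) x no-parallel) degH-x
  where
  open NoParallelHEdges G subcubic uncolourable critical {x} degH-x (subst (2 ≤_) (sym twoNbrEdges≡k) 2≤k)
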